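{- Let $(T,\mathbf{B})$ be a tree decomposition of a hypergraph $H$, let $x\in V(T)$, and let $V'_1,\dots,V'_r$ be the connected components of $T\setminus x$. Let $U_1,\dots,U_r$ be sets with $U_i\subseteq\mathbf{B}(V'_i)\setminus\mathbf{B}(x)$ for each $i$. Then $\rho\big(\bigcup_{i=1}^rU_i\big)=\sum_{i=1}^r\rho(U_i)$ and $\rho^*\big(\bigcup_{i=1}^rU_i\big)=\sum_{i=1}^r\rho^*(U_i)$.
   Context: A hypergraph $H$ has a finite vertex set $V(H)$ and a family $E(H)$ of subsets (hyperedges), with no isolated vertices. A tree decomposition of $H$ is a pair $(T,\mathbf{B})$ where $T$ is a tree and $\mathbf{B}:V(T)\to2^{V(H)}$ satisfies: bags cover $V(H)$; each hyperedge is contained in some bag; for every vertex $u$ the nodes whose bags contain $u$ induce a connected subtree. For $X'\subseteq V(T)$, $\mathbf{B}(X')=\bigcup_{y\in X'}\mathbf{B}(y)$. For $U\subseteq V(H)$, $\rho(U)$ is the smallest number of hyperedges of $H$ whose union contains $U$, and $\rho^*(U)$ is the minimum of $\sum_e\gamma(e)$ over $\gamma:E(H)\to[0,1]$ with $\sum_{e\ni u}\gamma(e)\ge1$ for all $u\in U$.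
   Formalization: The fractional edge covers γ defining $\rho^*$ take values in the rationals between 0 and 1 instead of the real interval $[0,1]$. -}

module Defs where

open import Data.Nat as ℕ using (ℕ; zero; suc)
open import Data.Fin using (Fin; zero; suc)
open import Data.Fin.Subset using (Subset; _∈_; _∉_; ∣_∣; ⋃)
open import Data.Fin.Subset.Properties using (_∈?_)
open import Data.Bool using (Bool; true; false)
open import Data.List as List using (List; []; _∷_; length)
open import Data.List.Relation.Unary.All using (All)
open import Data.List.Relation.Unary.AllPairs using (AllPairs)
open import Data.Rational as ℚ using (ℚ; 0ℚ; 1ℚ)
open import Data.Product using (Σ; ∃; ∃-syntax; _×_; _,_)
open import Relation.Binary.PropositionalEquality using (_≡_; _≢_)
open import Relation.Nullary using (¬_; does)
open import Data.Unit using (⊤)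
open import Data.Maybe using (just)

sumℕ : ∀ {r} → (Fin r → ℕ) → ℕ
sumℕ {zero}  f = 0
sumℕ {suc r} f = f zero ℕ.+ sumℕ (λ i → f (suc i))

sumℚ : ∀ {r} → (Fin r → ℚ) → ℚ
sumℚ {zero}  f = 0ℚ
sumℚ {suc r} f = f zero ℚ.+ sumℚ (λ i → f (suc i))

record Hypergraph : Set where
  field
    n  : ℕ
    m  : ℕ
    E  : Fin m → Subset n
    noIsolated : ∀ (v : Fin n) → ∃[ e ] (v ∈ E e)

record Graph : Set₁ where
  field
    t   : ℕ
    Adj : Fin t → Fin t → Set
    irrefl : ∀ u → ¬ Adj u u
    sym    : ∀ u v → Adj u v → Adj v u

module _ (G : Graph) where
  open Graph G

  Chain : List (Fin t) → Set
  Chain []           = ⊤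
  Chain (a ∷ [])     = ⊤
  Chain (a ∷ b ∷ xs) = Adj a b × Chain (b ∷ xs)

  record WalkWithin (P : Fin t → Set) (u v : Fin t) : Set where
    field
      vs     : List (Fin t)
      tail   : List (Fin t)
      shape  : vs ≡ u ∷ tail
      ends   : List.last vs ≡ just v
      chain  : Chain vs
      inside : All P vs

  Walk : Fin t → Fin t → Set
  Walk = WalkWithin (λ _ → ⊤)

  Connected : Set
  Connected = ∀ u v → Walk u v

  -- a cycle: at least three pairwise distinct vertices v₀ … v_k, consecutive
  -- ones adjacent, and v_k adjacent to v₀
  record Cycle : Set where
    field
      a b c  : Fin t
      rest   : List (Fin t)
      chain  : Chain (a ∷ b ∷ c ∷ rest)
      distinct : AllPairs _≢_ (a ∷ b ∷ c ∷ rest)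
      closing  : Adj (List.foldl (λ _ y → y) c rest) a

  Acyclic : Set
  Acyclic = ¬ Cycle

  IsTree : Set
  IsTree = Connected × Acyclic

module _ (T : Graph) (x : Fin (Graph.t T)) where
  open Graph T

  ConnectedAvoiding : Fin t → Fin t → Set
  ConnectedAvoiding = WalkWithin T (λ w → w ≢ x)

  record IsComponent (C : Subset t) : Set where
    field
      rep      : Fin t
      rep∈     : rep ∈ C
      rep≢x    : rep ≢ x
      exactly  : ∀ v → (v ∈ C → ConnectedAvoiding rep v)
                     × (ConnectedAvoiding rep v → v ∈ C)

  record AreComponents (r : ℕ) (C : Fin r → Subset t) : Set where
    field
      each      : ∀ i → IsComponent (C i)
      distinct  : ∀ i j → C i ≡ C j → i ≡ j
      covering  : ∀ v → v ≢ x → ∃[ i ] (v ∈ C i)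

record TreeDecomposition (H : Hypergraph) : Set₁ where
  open Hypergraph H
  field
    T      : Graph
    isTree : IsTree T
    B      : Fin (Graph.t T) → Subset n
    covers      : ∀ (v : Fin n) → ∃[ y ] (v ∈ B y)
    edgeInBag   : ∀ (e : Fin m) → ∃[ y ] (∀ v → v ∈ E e → v ∈ B y)
    connectivity : ∀ (v : Fin n) (y z : Fin (Graph.t T)) → v ∈ B y → v ∈ B z →
                   WalkWithin T (λ w → v ∈ B w) y z

  Bof : Subset (Graph.t T) → Fin n → Set
  Bof X' v = ∃[ y ] (y ∈ X' × v ∈ B y)

module _ (H : Hypergraph) where
  open Hypergraph H

  IsCover : Subset n → Subset m → Set
  IsCover U S = ∀ v → v ∈ U → ∃[ e ] (e ∈ S × v ∈ E e)

  IsRho : Subset n → ℕ → Set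
  IsRho U k = (∃[ S ] (IsCover U S × ∣ S ∣ ≡ k))
            × (∀ S → IsCover U S → k ℕ.≤ ∣ S ∣)

  weightAt : (Fin m → ℚ) → Fin n → ℚ
  weightAt γ v = sumℚ (λ e → if' (does (v ∈? E e)) (γ e))
    where
      if' : Bool → ℚ → ℚ
      if' true  q = q
      if' false _ = 0ℚ

  IsFracCover : Subset n → (Fin m → ℚ) → Set
  IsFracCover U γ = (∀ e → 0ℚ ℚ.≤ γ e × γ e ℚ.≤ 1ℚ)
                  × (∀ v → v ∈ U → 1ℚ ℚ.≤ weightAt γ v)

  IsRhoStar : Subset n → ℚ → Set
  IsRhoStar U q = (∃[ γ ] (IsFracCover U γ × sumℚ γ ≡ q))
                × (∀ γ → IsFracCover U γ → q ℚ.≤ sumℚ γ)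

bigUnion : ∀ {n r} → (Fin r → Subset n) → Subset n
bigUnion U = ⋃ (List.tabulate U)

{-# OPTIONS --safe #-}
module Submission where

-- A vertex outside B(x) occurs only in bags of one component of T ∖ x, because the nodes whose bags
-- contain it are connected; as every hyperedge lies inside a single bag, no hyperedge meets two of
-- the sets Uᵢ. For such a family, a (fractional) edge cover of ⋃ Uᵢ restricted to the hyperedges
-- meeting Uᵢ covers Uᵢ, and these restrictions together weigh at most the cover itself. Conversely,
-- covers of the Uᵢ glue to a cover of ⋃ Uᵢ in which each hyperedge keeps the weight given to it by
-- the unique Uᵢ it meets.

open import Algebra.Bundles using (CommutativeMonoid)
open import Data.Bool using (if_then_else_)
open import Data.Empty using (⊥-elim)
open import Data.Fin using (Fin; zero; suc)
open import Data.Fin.Properties using (0≢1+n; suc-injective; any?)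
open import Data.Fin.Subset using (Subset; _∈_; _∉_; _⊆_; ∣_∣; outside; inside)
open import Data.Fin.Subset.Properties using (⊆-antisym; _∈?_; x∈p∪q⁺; x∈p∪q⁻; ∉⊥)
open import Data.List using ([]; _∷_; last)
open import Data.List.Relation.Unary.All using (All; []; _∷_)
open import Data.Maybe using (just)
open import Data.Nat as ℕ using (ℕ; zero; suc)
import Data.Nat.Properties as ℕP
open import Data.Product using (_×_; _,_; proj₁; proj₂; ∃-syntax)
open import Data.Rational as ℚ using (ℚ; 0ℚ; 1ℚ)
import Data.Rational.Properties as ℚP
open import Data.Sum using (inj₁; inj₂)
open import Data.Unit using (tt)
open import Data.Vec using (tabulate; []; _∷_)
open import Data.Vec.Properties using (lookup∘tabulate; lookup⇒[]=; []=⇒lookup)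
open import Function using (_∘_)
open import Level using (0ℓ)
open import Relation.Binary using (Rel; Preorder; IsPreorder; _Preserves₂_⟶_⟶_)
open import Relation.Binary.Construct.Closure.ReflexiveTransitive using (Star; ε; _◅_; _◅◅_; reverse; map)
open import Relation.Binary.PropositionalEquality using (_≡_; _≢_; refl; sym; trans; cong; subst)
open import Relation.Nullary using (¬_; Dec; yes; no; does)
open import Relation.Nullary.Decidable using (_×-dec_; dec-true; dec-false)
open import Relation.Unary using (Pred; Decidable)

open import Defs

module _ (M : CommutativeMonoid 0ℓ 0ℓ) where
  open CommutativeMonoid M using (Carrier; _≈_; identityˡ; identityʳ)
    renaming (_∙_ to _+_; ε to 0#; refl to ≈-refl; sym to ≈-sym; trans to ≈-trans;
              ∙-cong to +-cong; ∙-congˡ to +-congˡ; ∙-congʳ to +-congʳ)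
  open import Algebra.Properties.CommutativeMonoid.Sum M as Sum using (sum)

  -- ∑ is a parameter, rather than the library's sum, so that sumℕ and sumℚ of Defs are instances.
  module PreorderedSum
    {_≤_ : Rel Carrier 0ℓ} (≤-isPreorder : IsPreorder _≈_ _≤_)
    (+-mono-≤ : _+_ Preserves₂ _≤_ ⟶ _≤_ ⟶ _≤_)
    (∑ : ∀ {r} → (Fin r → Carrier) → Carrier)
    (∑-zero : (f : Fin 0 → Carrier) → ∑ f ≈ 0#)
    (∑-suc : ∀ {r} (f : Fin (suc r) → Carrier) → ∑ f ≈ f zero + ∑ (f ∘ suc))
    where

    ≤-preorder : Preorder 0ℓ 0ℓ 0ℓ
    ≤-preorder = record { isPreorder = ≤-isPreorder }

    open import Relation.Binary.Reasoning.Preorder ≤-preorder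
    open IsPreorder ≤-isPreorder using () renaming (refl to ≤-refl)

    ∑-cong : ∀ {r} {f g : Fin r → Carrier} → (∀ i → f i ≈ g i) → ∑ f ≈ ∑ g
    ∑-cong {zero}  f≈g = ≈-trans (∑-zero _) (≈-sym (∑-zero _))
    ∑-cong {suc r} f≈g = ≈-trans (∑-suc _) (≈-trans (+-cong (f≈g zero) (∑-cong (f≈g ∘ suc))) (≈-sym (∑-suc _)))

    ∑-mono-≤ : ∀ {r} {f g : Fin r → Carrier} → (∀ i → f i ≤ g i) → ∑ f ≤ ∑ g
    ∑-mono-≤ {zero}  {f} {g} f≤g = begin
      ∑ f ≈⟨ ∑-zero f ⟩
      0#  ≈⟨ ∑-zero g ⟨
      ∑ g ∎
    ∑-mono-≤ {suc r} {f} {g} f≤g = begin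
      ∑ f                      ≈⟨ ∑-suc f ⟩
      f zero + ∑ (f ∘ suc)     ∼⟨ +-mono-≤ (f≤g zero) (∑-mono-≤ (f≤g ∘ suc)) ⟩
      g zero + ∑ (g ∘ suc)     ≈⟨ ∑-suc g ⟨
      ∑ g                      ∎

    ∑≈sum : ∀ {r} (f : Fin r → Carrier) → ∑ f ≈ sum f
    ∑≈sum {zero}  f = ∑-zero f
    ∑≈sum {suc r} f = ≈-trans (∑-suc f) (+-congˡ (∑≈sum (f ∘ suc)))

    ∑-comm : ∀ {r s} (f : Fin r → Fin s → Carrier) → ∑ (λ i → ∑ (f i)) ≈ ∑ (λ j → ∑ (λ i → f i j))
    ∑-comm f = begin-equality
      ∑ (λ i → ∑ (f i))             ≈⟨ ∑-cong (λ i → ∑≈sum (f i)) ⟩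
      ∑ (λ i → sum (f i))           ≈⟨ ∑≈sum _ ⟩
      sum (λ i → sum (f i))         ≈⟨ Sum.∑-comm f ⟩
      sum (λ j → sum (λ i → f i j)) ≈⟨ ∑≈sum _ ⟨
      ∑ (λ j → sum (λ i → f i j))   ≈⟨ ∑-cong (λ j → ∑≈sum _) ⟨
      ∑ (λ j → ∑ (λ i → f i j))     ∎

    ∑-≈0 : ∀ {r} {f : Fin r → Carrier} → (∀ i → f i ≈ 0#) → ∑ f ≈ 0#
    ∑-≈0 {r} f≈0 = ≈-trans (∑-cong f≈0) (≈-trans (∑≈sum _) (Sum.sum-replicate-zero r))

    ∑-nonneg : ∀ {r} {f : Fin r → Carrier} → (∀ i → 0# ≤ f i) → 0# ≤ ∑ f
    ∑-nonneg {f = f} 0≤f = begin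
      0#             ≈⟨ ∑-≈0 (λ _ → ≈-refl) ⟨
      ∑ (λ _ → 0#)  ∼⟨ ∑-mono-≤ 0≤f ⟩
      ∑ f           ∎

    term≤∑ : ∀ {r} {f : Fin r → Carrier} → (∀ i → 0# ≤ f i) → ∀ j → f j ≤ ∑ f
    term≤∑ {suc r} {f} 0≤f zero = begin
      f zero                ≈⟨ identityʳ (f zero) ⟨
      f zero + 0#           ∼⟨ +-mono-≤ ≤-refl (∑-nonneg (0≤f ∘ suc)) ⟩
      f zero + ∑ (f ∘ suc)  ≈⟨ ∑-suc f ⟨
      ∑ f                   ∎
    term≤∑ {suc r} {f} 0≤f (suc j) = begin
      f (suc j)             ≈⟨ identityˡ (f (suc j)) ⟨
      0# + f (suc j)        ∼⟨ +-mono-≤ (0≤f zero) (term≤∑ (0≤f ∘ suc) j) ⟩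
      f zero + ∑ (f ∘ suc)  ≈⟨ ∑-suc f ⟨
      ∑ f                   ∎

    ∑-≤-singleSupport : ∀ {r} {P : Pred (Fin r) 0ℓ} {f : Fin r → Carrier} {a : Carrier} → Decidable P →
      (∀ i j → P i → P j → i ≡ j) → (∀ i → ¬ P i → f i ≈ 0#) → (∀ i → f i ≤ a) → 0# ≤ a → ∑ f ≤ a
    ∑-≤-singleSupport {zero} {f = f} _ _ _ _ 0≤a = begin
      ∑ f ≈⟨ ∑-zero f ⟩
      0#  ∼⟨ 0≤a ⟩
      _   ∎
    ∑-≤-singleSupport {suc r} {P} {f} {a} P? unique off f≤a 0≤a with P? zero
    ... | yes P0 = begin
      ∑ f                   ≈⟨ ∑-suc f ⟩
      f zero + ∑ (f ∘ suc)  ≈⟨ +-congˡ (∑-≈0 (λ i → off (suc i) (0≢1+n ∘ unique zero (suc i) P0))) ⟩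
      f zero + 0#           ≈⟨ identityʳ (f zero) ⟩
      f zero                ∼⟨ f≤a zero ⟩
      a                     ∎
    ... | no ¬P0 = begin
      ∑ f                   ≈⟨ ∑-suc f ⟩
      f zero + ∑ (f ∘ suc)  ≈⟨ +-congʳ (off zero ¬P0) ⟩
      0# + ∑ (f ∘ suc)      ≈⟨ identityˡ _ ⟩
      ∑ (f ∘ suc)           ∼⟨ ∑-≤-singleSupport (P? ∘ suc) unique′ (off ∘ suc) (f≤a ∘ suc) 0≤a ⟩
      a                     ∎
      where
      unique′ : ∀ i j → P (suc i) → P (suc j) → i ≡ j
      unique′ i j Pi Pj = suc-injective (unique (suc i) (suc j) Pi Pj)

module _ (G : Graph) where
  open Graph G using (t; Adj) renaming (sym to Adj-sym)

  EdgeWithin : Pred (Fin t) 0ℓ → Rel (Fin t) 0ℓ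
  EdgeWithin P u v = P u × Adj u v × P v

  PathWithin : Pred (Fin t) 0ℓ → Rel (Fin t) 0ℓ
  PathWithin P = Star (EdgeWithin P)

  module _ {P : Pred (Fin t) 0ℓ} where

    chain⇒path : ∀ {u v} ws → last (u ∷ ws) ≡ just v →
                 Chain G (u ∷ ws) → All P (u ∷ ws) → PathWithin P u v
    chain⇒path []       refl _            _                  = ε
    chain⇒path (w ∷ ws) ends (u~w , chain) (Pu ∷ Pws@(Pw ∷ _)) =
      (Pu , u~w , Pw) ◅ chain⇒path ws ends chain Pws

    walk⇒path : ∀ {u v} → WalkWithin G P u v → PathWithin P u v
    walk⇒path record { shape = refl ; ends = ends ; chain = chain ; inside = Pvs } =
      chain⇒path _ ends chain Pvs

    path⇒walk : ∀ {u v} → P u → PathWithin P u v → WalkWithin G P u v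
    path⇒walk {u} Pu ε = record
      { vs = u ∷ [] ; tail = [] ; shape = refl ; ends = refl ; chain = tt ; inside = Pu ∷ [] }
    path⇒walk {u} Pu ((_ , u~w , Pw) ◅ p) with path⇒walk Pw p
    ... | record { shape = refl ; ends = ends ; chain = chain ; inside = Pvs } = record
      { vs = u ∷ _ ; tail = _ ; shape = refl ; ends = ends ; chain = u~w , chain ; inside = Pu ∷ Pvs }

    path-reverse : ∀ {u v} → PathWithin P u v → PathWithin P v u
    path-reverse = reverse (λ (Pu , u~v , Pv) → Pv , Adj-sym _ _ u~v , Pu)

  path-weaken : ∀ {P Q : Pred (Fin t) 0ℓ} → (∀ {w} → P w → Q w) → ∀ {u v} → PathWithin P u v → PathWithin Q u v
  path-weaken P⇒Q = map (λ (Pu , u~v , Pv) → P⇒Q Pu , u~v , P⇒Q Pv)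

module _ (T : Graph) (x : Fin (Graph.t T)) where
  open Graph T using (t)

  AvoidingPath : Rel (Fin t) 0ℓ
  AvoidingPath = PathWithin T (_≢ x)

  module _ {C : Subset t} (component : IsComponent T x C) where
    open IsComponent component

    path-from-rep : ∀ {v} → v ∈ C → AvoidingPath rep v
    path-from-rep {v} v∈C = walk⇒path T (proj₁ (exactly v) v∈C)

    component-closed : ∀ {u v} → u ∈ C → AvoidingPath u v → v ∈ C
    component-closed {v = v} u∈C u⇝v = proj₂ (exactly v) (path⇒walk T rep≢x (path-from-rep u∈C ◅◅ u⇝v))

    component-connected : ∀ {u v} → u ∈ C → v ∈ C → AvoidingPath u v
    component-connected u∈C v∈C = path-reverse T (path-from-rep u∈C) ◅◅ path-from-rep v∈C

  component-⊆ : ∀ {C D y} → IsComponent T x C → IsComponent T x D → y ∈ C → y ∈ D → C ⊆ D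
  component-⊆ C-comp D-comp y∈C y∈D u∈C = component-closed D-comp y∈D (component-connected C-comp y∈C u∈C)

  component-index-unique : ∀ {r C} → AreComponents T x r C → ∀ {i j y} → y ∈ C i → y ∈ C j → i ≡ j
  component-index-unique components {i} {j} y∈Ci y∈Cj =
    distinct i j (⊆-antisym (component-⊆ (each i) (each j) y∈Ci y∈Cj) (component-⊆ (each j) (each i) y∈Cj y∈Ci))
    where open AreComponents components


EdgeSeparated : (H : Hypergraph) → ∀ {r} → (Fin r → Subset (Hypergraph.n H)) → Set
EdgeSeparated H U = ∀ e {i j v w} → v ∈ U i → v ∈ E e → w ∈ U j → w ∈ E e → i ≡ j
  where open Hypergraph H

module _ {H : Hypergraph} (TD : TreeDecomposition H) where
  open Hypergraph H
  open TreeDecomposition TD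

  occurrences-in-component : ∀ {x C v y z} → IsComponent T x C → v ∉ B x → z ∈ C → v ∈ B z → v ∈ B y → y ∈ C
  occurrences-in-component {x} comp v∉Bx z∈C v∈Bz v∈By = component-closed T x comp z∈C
    (path-weaken T (λ v∈Bw w≡x → v∉Bx (subst (λ w → _ ∈ B w) w≡x v∈Bw)) (walk⇒path T (connectivity _ _ _ v∈Bz v∈By)))

  components-separate : ∀ {x r C} → AreComponents T x r C → (U : Fin r → Subset n) →
    (∀ i v → v ∈ U i → Bof (C i) v × v ∉ B x) → EdgeSeparated H U
  components-separate {x} {C = C} comps U U⊆ e v∈Ui v∈e w∈Uj w∈e with edgeInBag e
  ... | y , e⊆By = component-index-unique T x comps (y∈C v∈Ui (e⊆By _ v∈e)) (y∈C w∈Uj (e⊆By _ w∈e))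
    where
    y∈C : ∀ {i v} → v ∈ U i → v ∈ B y → y ∈ C i
    y∈C {i} v∈Ui v∈By with U⊆ i _ v∈Ui
    ... | (z , z∈Ci , v∈Bz) , v∉Bx = occurrences-in-component (AreComponents.each comps i) v∉Bx z∈Ci v∈Bz v∈By

subsetOf : ∀ {n} {P : Pred (Fin n) 0ℓ} → Decidable P → Subset n
subsetOf P? = tabulate (does ∘ P?)

module _ {n} {P : Pred (Fin n) 0ℓ} (P? : Decidable P) where

  ∈-subsetOf⁺ : ∀ {i} → P i → i ∈ subsetOf P?
  ∈-subsetOf⁺ {i} Pi = lookup⇒[]= i _ (trans (lookup∘tabulate _ i) (dec-true (P? i) Pi))

  ∈-subsetOf⁻ : ∀ {i} → i ∈ subsetOf P? → P i
  ∈-subsetOf⁻ {i} i∈ with P? i | trans (sym (lookup∘tabulate (does ∘ P?) i)) ([]=⇒lookup i∈)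
  ... | yes Pi | _  = Pi
  ... | no  _  | ()

∈-bigUnion⁺ : ∀ {n r} (S : Fin r → Subset n) {v} i → v ∈ S i → v ∈ bigUnion S
∈-bigUnion⁺ S zero    v∈S₀ = x∈p∪q⁺ (inj₁ v∈S₀)
∈-bigUnion⁺ S (suc i) v∈Sᵢ = x∈p∪q⁺ {p = S zero} (inj₂ (∈-bigUnion⁺ (S ∘ suc) i v∈Sᵢ))

∈-bigUnion⁻ : ∀ {n r} (S : Fin r → Subset n) {v} → v ∈ bigUnion S → ∃[ i ] v ∈ S i
∈-bigUnion⁻ {r = zero}  S v∈⋃ = ⊥-elim (∉⊥ v∈⋃)
∈-bigUnion⁻ {r = suc r} S v∈⋃ with x∈p∪q⁻ (S zero) _ v∈⋃
... | inj₁ v∈S₀ = zero , v∈S₀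
... | inj₂ v∈⋃′ with ∈-bigUnion⁻ (S ∘ suc) v∈⋃′
...   | i , v∈Sᵢ = suc i , v∈Sᵢ

module ℕ-Sum = PreorderedSum ℕP.+-0-commutativeMonoid ℕP.≤-isPreorder ℕP.+-mono-≤ sumℕ (λ _ → refl) (λ _ → refl)
module ℚ-Sum = PreorderedSum ℚP.+-0-commutativeMonoid ℚP.≤-isPreorder ℚP.+-mono-≤ sumℚ (λ _ → refl) (λ _ → refl)

indicator : ∀ {n} → Subset n → Fin n → ℕ
indicator S i = if does (i ∈? S) then 1 else 0

∣∣≡∑indicator : ∀ {n} (S : Subset n) → ∣ S ∣ ≡ sumℕ (indicator S)
∣∣≡∑indicator []            = refl
∣∣≡∑indicator (inside  ∷ S) = cong suc (∣∣≡∑indicator S)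
∣∣≡∑indicator (outside ∷ S) = ∣∣≡∑indicator S

module _ {n} {S : Subset n} {i : Fin n} where

  indicator-∈ : i ∈ S → indicator S i ≡ 1
  indicator-∈ i∈S rewrite dec-true (i ∈? S) i∈S = refl

  indicator-∉ : i ∉ S → indicator S i ≡ 0
  indicator-∉ i∉S rewrite dec-false (i ∈? S) i∉S = refl

indicator-mono : ∀ {n} {S S′ : Subset n} {i} → (i ∈ S → i ∈ S′) → indicator S i ℕ.≤ indicator S′ i
indicator-mono {S = S} {i = i} S⇒S′ with i ∈? S
... | yes i∈S = ℕP.≤-reflexive (sym (indicator-∈ (S⇒S′ i∈S)))
... | no  _   = ℕ.z≤n

indicator-bigUnion≤∑ : ∀ {n r} (S : Fin r → Subset n) i → indicator (bigUnion S) i ℕ.≤ sumℕ (λ j → indicator (S j) i)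
indicator-bigUnion≤∑ S i with i ∈? bigUnion S
... | no  _    = ℕ.z≤n
... | yes i∈⋃ with ∈-bigUnion⁻ S i∈⋃
...   | j , i∈Sⱼ = ℕP.≤-trans (ℕP.≤-reflexive (sym (indicator-∈ i∈Sⱼ))) (ℕ-Sum.term≤∑ (λ _ → ℕ.z≤n) j)

∣bigUnion∣≤∑∣∣ : ∀ {n r} (S : Fin r → Subset n) → ∣ bigUnion S ∣ ℕ.≤ sumℕ (λ i → ∣ S i ∣)
∣bigUnion∣≤∑∣∣ S = begin
  ∣ bigUnion S ∣                                   ≡⟨ ∣∣≡∑indicator (bigUnion S) ⟩
  sumℕ (indicator (bigUnion S))                   ≤⟨ ℕ-Sum.∑-mono-≤ (indicator-bigUnion≤∑ S) ⟩
  sumℕ (λ e → sumℕ (λ i → indicator (S i) e))    ≡⟨ ℕ-Sum.∑-comm (indicator ∘ S) ⟨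
  sumℕ (λ i → sumℕ (indicator (S i)))            ≡⟨ ℕ-Sum.∑-cong (λ i → ∣∣≡∑indicator (S i)) ⟨
  sumℕ (λ i → ∣ S i ∣)                            ∎
  where open ℕP.≤-Reasoning

InUnitInterval : ℚ → Set
InUnitInterval q = 0ℚ ℚ.≤ q × q ℚ.≤ 1ℚ

module _ (H : Hypergraph) where
  open Hypergraph H

  union-covers : ∀ {r} {U : Fin r → Subset n} {S : Fin r → Subset m} →
    (∀ i → IsCover H (U i) (S i)) → IsCover H (bigUnion U) (bigUnion S)
  union-covers {U = U} {S} S-covers v v∈⋃U with ∈-bigUnion⁻ U v∈⋃U
  ... | i , v∈Uᵢ with S-covers i v v∈Uᵢ
  ...   | e , e∈Sᵢ , v∈e = e , ∈-bigUnion⁺ S i e∈Sᵢ , v∈e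

  -- weightAt's summand is a where-local function of Defs that cannot be named here, so the type of
  -- summand-mono is left to unification with its use in mono, which is therefore checked first.
  weightAt-mono : ∀ {γ γ′ : Fin m → ℚ} v → (∀ e → v ∈ E e → γ e ℚ.≤ γ′ e) → weightAt H γ v ℚ.≤ weightAt H γ′ v
  weightAt-mono {γ} {γ′} v γ≤γ′ = mono
    where
    summand-mono : ∀ e → _ ℚ.≤ _
    mono : weightAt H γ v ℚ.≤ weightAt H γ′ v
    mono = ℚ-Sum.∑-mono-≤ summand-mono
    summand-mono e with v ∈? E e
    ... | yes v∈e = γ≤γ′ e v∈e
    ... | no  _   = ℚP.≤-refl

module Additivity (H : Hypergraph) {r} (U : Fin r → Subset (Hypergraph.n H)) (separated : EdgeSeparated H U) where
  open Hypergraph H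

  Touches : Fin m → Fin r → Set
  Touches e i = ∃[ v ] (v ∈ U i × v ∈ E e)

  touches? : ∀ e i → Dec (Touches e i)
  touches? e i = any? (λ v → v ∈? U i ×-dec v ∈? E e)

  touches-unique : ∀ e i j → Touches e i → Touches e j → i ≡ j
  touches-unique e i j (v , v∈Uᵢ , v∈e) (w , w∈Uⱼ , w∈e) = separated e v∈Uᵢ v∈e w∈Uⱼ w∈e

  _∩touching_ : Subset m → Fin r → Subset m
  S ∩touching i = subsetOf (λ e → e ∈? S ×-dec touches? e i)

  ∩touching-covers : ∀ {S} → IsCover H (bigUnion U) S → ∀ i → IsCover H (U i) (S ∩touching i)
  ∩touching-covers S-covers i v v∈Uᵢ with S-covers v (∈-bigUnion⁺ U i v∈Uᵢ)
  ... | e , e∈S , v∈e = e , ∈-subsetOf⁺ (λ e → e ∈? _ ×-dec touches? e i) (e∈S , v , v∈Uᵢ , v∈e) , v∈e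

  ∑∣∩touching∣≤∣∣ : ∀ S → sumℕ (λ i → ∣ S ∩touching i ∣) ℕ.≤ ∣ S ∣
  ∑∣∩touching∣≤∣∣ S = begin
    sumℕ (λ i → ∣ S ∩touching i ∣)                            ≡⟨ ℕ-Sum.∑-cong (λ i → ∣∣≡∑indicator (S ∩touching i)) ⟩
    sumℕ (λ i → sumℕ (indicator (S ∩touching i)))             ≡⟨ ℕ-Sum.∑-comm (λ i → indicator (S ∩touching i)) ⟩
    sumℕ (λ e → sumℕ (λ i → indicator (S ∩touching i) e))     ≤⟨ ℕ-Sum.∑-mono-≤ at-most-one-part ⟩
    sumℕ (indicator S)                                        ≡⟨ ∣∣≡∑indicator S ⟨
    ∣ S ∣                                                     ∎
    where
    open ℕP.≤-Reasoning
    ∈-∩touching⁻ : ∀ {e i} → e ∈ S ∩touching i → e ∈ S × Touches e i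
    ∈-∩touching⁻ {i = i} = ∈-subsetOf⁻ (λ e → e ∈? S ×-dec touches? e i)
    at-most-one-part : ∀ e → sumℕ (λ i → indicator (S ∩touching i) e) ℕ.≤ indicator S e
    at-most-one-part e = ℕ-Sum.∑-≤-singleSupport (touches? e) (touches-unique e)
      (λ i ¬touches → indicator-∉ {i = e} (¬touches ∘ proj₂ ∘ ∈-∩touching⁻))
      (λ i → indicator-mono {i = e} (proj₁ ∘ ∈-∩touching⁻)) ℕ.z≤n

  ρ-additive : ∀ k (ks : Fin r → ℕ) → IsRho H (bigUnion U) k → (∀ i → IsRho H (U i) (ks i)) → k ≡ sumℕ ks
  ρ-additive k ks ((S , S-covers , ∣S∣≡k) , k-minimal) ρᵢ = ℕP.≤-antisym subadditive superadditive
    where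
    open ℕP.≤-Reasoning
    Sᵢ : Fin r → Subset m
    Sᵢ i = proj₁ (proj₁ (ρᵢ i))
    Sᵢ-covers : ∀ i → IsCover H (U i) (Sᵢ i)
    Sᵢ-covers i = proj₁ (proj₂ (proj₁ (ρᵢ i)))
    ∣Sᵢ∣≡ks : ∀ i → ∣ Sᵢ i ∣ ≡ ks i
    ∣Sᵢ∣≡ks i = proj₂ (proj₂ (proj₁ (ρᵢ i)))
    subadditive : k ℕ.≤ sumℕ ks
    subadditive = begin
      k                        ≤⟨ k-minimal (bigUnion Sᵢ) (union-covers H Sᵢ-covers) ⟩
      ∣ bigUnion Sᵢ ∣           ≤⟨ ∣bigUnion∣≤∑∣∣ Sᵢ ⟩
      sumℕ (λ i → ∣ Sᵢ i ∣)    ≡⟨ ℕ-Sum.∑-cong ∣Sᵢ∣≡ks ⟩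
      sumℕ ks                  ∎
    superadditive : sumℕ ks ℕ.≤ k
    superadditive = begin
      sumℕ ks                          ≤⟨ ℕ-Sum.∑-mono-≤ (λ i → proj₂ (ρᵢ i) (S ∩touching i) (∩touching-covers S-covers i)) ⟩
      sumℕ (λ i → ∣ S ∩touching i ∣)  ≤⟨ ∑∣∩touching∣≤∣∣ S ⟩
      ∣ S ∣                            ≡⟨ ∣S∣≡k ⟩
      k                                ∎

  _↾_ : (Fin m → ℚ) → Fin r → Fin m → ℚ
  (γ ↾ i) e = if does (touches? e i) then γ e else 0ℚ

  module _ (γ : Fin m → ℚ) (i : Fin r) (e : Fin m) where

    ↾-touching : Touches e i → (γ ↾ i) e ≡ γ e
    ↾-touching touches rewrite dec-true (touches? e i) touches = refl

    ↾-elsewhere : ¬ Touches e i → (γ ↾ i) e ≡ 0ℚ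
    ↾-elsewhere ¬touches rewrite dec-false (touches? e i) ¬touches = refl

    ↾-≤ : 0ℚ ℚ.≤ γ e → (γ ↾ i) e ℚ.≤ γ e
    ↾-≤ 0≤γ with touches? e i
    ... | yes _ = ℚP.≤-refl
    ... | no  _ = 0≤γ

    ↾-unitInterval : InUnitInterval (γ e) → InUnitInterval ((γ ↾ i) e)
    ↾-unitInterval γ∈[0,1] with touches? e i
    ... | yes _ = γ∈[0,1]
    ... | no  _ = ℚP.≤-refl , ℚP.nonNegative⁻¹ 1ℚ

  gather : (Fin r → Fin m → ℚ) → Fin m → ℚ
  gather γs e = sumℚ (λ i → (γs i ↾ i) e)

  ↾-fracCover : ∀ {γ} → IsFracCover H (bigUnion U) γ → ∀ i → IsFracCover H (U i) (γ ↾ i)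
  ↾-fracCover {γ} (γ-bounded , γ-covers) i = (λ e → ↾-unitInterval γ i e (γ-bounded e)) , covers
    where
    covers : ∀ v → v ∈ U i → 1ℚ ℚ.≤ weightAt H (γ ↾ i) v
    covers v v∈Uᵢ = ℚP.≤-trans (γ-covers v (∈-bigUnion⁺ U i v∈Uᵢ))
      (weightAt-mono H v (λ e v∈e → ℚP.≤-reflexive (sym (↾-touching γ i e (v , v∈Uᵢ , v∈e)))))

  ∑∑↾≤∑ : ∀ {γ} → (∀ e → 0ℚ ℚ.≤ γ e) → sumℚ (λ i → sumℚ (γ ↾ i)) ℚ.≤ sumℚ γ
  ∑∑↾≤∑ {γ} 0≤γ = begin
    sumℚ (λ i → sumℚ (γ ↾ i))           ≡⟨ ℚ-Sum.∑-comm (γ ↾_) ⟩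
    sumℚ (λ e → sumℚ (λ i → (γ ↾ i) e)) ≤⟨ ℚ-Sum.∑-mono-≤ at-most-one-part ⟩
    sumℚ γ                               ∎
    where
    open ℚP.≤-Reasoning
    at-most-one-part : ∀ e → sumℚ (λ i → (γ ↾ i) e) ℚ.≤ γ e
    at-most-one-part e = ℚ-Sum.∑-≤-singleSupport (touches? e) (touches-unique e)
      (λ i → ↾-elsewhere γ i e) (λ i → ↾-≤ γ i e (0≤γ e)) (0≤γ e)

  gather-fracCover : ∀ {γs} → (∀ i → IsFracCover H (U i) (γs i)) → IsFracCover H (bigUnion U) (gather γs)
  gather-fracCover {γs} γs-covers = bounded , covers
    where
    ↾-unitInterval-at : ∀ i e → InUnitInterval ((γs i ↾ i) e)
    ↾-unitInterval-at i e = ↾-unitInterval (γs i) i e (proj₁ (γs-covers i) e)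
    bounded : ∀ e → InUnitInterval (gather γs e)
    bounded e = ℚ-Sum.∑-nonneg (λ i → proj₁ (↾-unitInterval-at i e))
              , ℚ-Sum.∑-≤-singleSupport (touches? e) (touches-unique e) (λ i → ↾-elsewhere (γs i) i e)
                  (λ i → proj₂ (↾-unitInterval-at i e)) (ℚP.nonNegative⁻¹ 1ℚ)
    covers : ∀ v → v ∈ bigUnion U → 1ℚ ℚ.≤ weightAt H (gather γs) v
    covers v v∈⋃U with ∈-bigUnion⁻ U v∈⋃U
    ... | i , v∈Uᵢ = ℚP.≤-trans (proj₂ (γs-covers i) v v∈Uᵢ) (weightAt-mono H v γsᵢ≤gather)
      where
      γsᵢ≤gather : ∀ e → v ∈ E e → γs i e ℚ.≤ gather γs e
      γsᵢ≤gather e v∈e = ℚP.≤-trans (ℚP.≤-reflexive (sym (↾-touching (γs i) i e (v , v∈Uᵢ , v∈e))))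
        (ℚ-Sum.term≤∑ (λ j → proj₁ (↾-unitInterval-at j e)) i)

  ∑gather≤∑∑ : ∀ {γs} → (∀ i e → 0ℚ ℚ.≤ γs i e) → sumℚ (gather γs) ℚ.≤ sumℚ (λ i → sumℚ (γs i))
  ∑gather≤∑∑ {γs} 0≤γs = begin
    sumℚ (gather γs)                  ≤⟨ ℚ-Sum.∑-mono-≤ (λ e → ℚ-Sum.∑-mono-≤ (λ i → ↾-≤ (γs i) i e (0≤γs i e))) ⟩
    sumℚ (λ e → sumℚ (λ i → γs i e)) ≡⟨ ℚ-Sum.∑-comm γs ⟨
    sumℚ (λ i → sumℚ (γs i))         ∎
    where open ℚP.≤-Reasoning

  ρ*-additive : ∀ q (qs : Fin r → ℚ) → IsRhoStar H (bigUnion U) q → (∀ i → IsRhoStar H (U i) (qs i)) → q ≡ sumℚ qs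
  ρ*-additive q qs ((γ , γ-covers , ∑γ≡q) , q-minimal) ρ*ᵢ = ℚP.≤-antisym subadditive superadditive
    where
    open ℚP.≤-Reasoning
    γs : Fin r → Fin m → ℚ
    γs i = proj₁ (proj₁ (ρ*ᵢ i))
    γs-covers : ∀ i → IsFracCover H (U i) (γs i)
    γs-covers i = proj₁ (proj₂ (proj₁ (ρ*ᵢ i)))
    ∑γs≡qs : ∀ i → sumℚ (γs i) ≡ qs i
    ∑γs≡qs i = proj₂ (proj₂ (proj₁ (ρ*ᵢ i)))
    subadditive : q ℚ.≤ sumℚ qs
    subadditive = begin
      q                          ≤⟨ q-minimal (gather γs) (gather-fracCover γs-covers) ⟩
      sumℚ (gather γs)           ≤⟨ ∑gather≤∑∑ (λ i e → proj₁ (proj₁ (γs-covers i) e)) ⟩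
      sumℚ (λ i → sumℚ (γs i))  ≡⟨ ℚ-Sum.∑-cong ∑γs≡qs ⟩
      sumℚ qs                    ∎
    superadditive : sumℚ qs ℚ.≤ q
    superadditive = begin
      sumℚ qs                    ≤⟨ ℚ-Sum.∑-mono-≤ (λ i → proj₂ (ρ*ᵢ i) (γ ↾ i) (↾-fracCover γ-covers i)) ⟩
      sumℚ (λ i → sumℚ (γ ↾ i)) ≤⟨ ∑∑↾≤∑ (proj₁ ∘ proj₁ γ-covers) ⟩
      sumℚ γ                     ≡⟨ ∑γ≡q ⟩
      q                          ∎

mainTheorem12 : (H : Hypergraph) (TD : TreeDecomposition H)
    (x : Fin (Graph.t (TreeDecomposition.T TD)))
    (r : ℕ) (C : Fin r → Subset (Graph.t (TreeDecomposition.T TD)))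
    → AreComponents (TreeDecomposition.T TD) x r C
    → (U : Fin r → Subset (Hypergraph.n H))
    → (∀ i v → v ∈ U i → TreeDecomposition.Bof TD (C i) v × v ∉ TreeDecomposition.B TD x)
    → (∀ (k : ℕ) (ks : Fin r → ℕ) → IsRho H (bigUnion U) k → (∀ i → IsRho H (U i) (ks i))
         → k ≡ sumℕ ks)
      × (∀ (q : ℚ) (qs : Fin r → ℚ) → IsRhoStar H (bigUnion U) q
         → (∀ i → IsRhoStar H (U i) (qs i)) → q ≡ sumℚ qs)
mainTheorem12 H TD x r C components U U⊆ = ρ-additive , ρ*-additive
  where open Additivity H U (components-separate TD components U U⊆)
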